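{- Let $n$ be large enough. Let $\mathcal{H} = (X,\mathcal{F})$ be a hypergraph with $|X|=n$, $|\mathcal{F}|\leq n^{\log(n)}$ and such that every hyperedge contains at least $\log^3(n)$ vertices. Then in the Waiter-Client game on $\mathcal{H}$, Waiter has a strategy such that at the end of the game the set $C$ of Client's elements satisfies $|C\cap f| \geq \frac{|f|}{100}$ for every $f\in \mathcal{F}$.
   Context: Waiter-Client game on a hypergraph $(X,\mathcal{F})$: in each round Waiter offers Client two previously unclaimed elements of $X$; Client keeps one and the other goes to Waiter; if in the final round only one unclaimed element remains, it goes to Waiter. The game ends when all elements of $X$ are claimed. -}

module Defs where

open import Data.Nat using (ℕ; zero; suc; _+_; _*_; _^_; _≤_; _<_)
open import Data.Fin using (Fin)
open import Data.Fin.Subset using (Subset; _∈_; _∪_; _∩_; _-_; ⁅_⁆; ∣_∣; ⊤; ⊥)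
open import Data.List using (List; length)
open import Data.List.Relation.Unary.All using (All)
open import Relation.Binary.PropositionalEquality using (_≢_)

-- Real-number conditions involving log = log₂, encoded exactly in ℕ
-- through rational approximations p/q (q > 0).
--
-- For reals a, b:  a ≤ b  iff  every rational r > b satisfies a < r.
-- Also  log₂ n < p/q  iff  n ^ q < 2 ^ p.

-- (log₂ n)³ ≤ k  :  log₂ n ≤ k^(1/3), i.e. every p/q with (p/q)³ > k
-- satisfies log₂ n < p/q.
Log₂Cubed≤ : ℕ → ℕ → Set
Log₂Cubed≤ n k = ∀ p q → 0 < q → k * (q ^ 3) < p ^ 3 → n ^ q < 2 ^ p

-- m ≤ n ^ (log₂ n)  :  log₂ m ≤ (log₂ n)², i.e. every p/q > log₂ n
-- satisfies log₂ m < (p/q)², i.e. m ^ (q²) < 2 ^ (p²).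
≤PowLog₂ : ℕ → ℕ → Set
≤PowLog₂ n m = ∀ p q → 0 < q → n ^ q < 2 ^ p → m ^ (q * q) < 2 ^ (p * p)

-- A position consists of the set U of unclaimed elements and the set C of
-- Client's elements (Waiter owns the rest).  When at most one unclaimed element
-- remains the game ends (a single remaining element goes to Waiter, so C
-- does not change).

data WaiterWins {n : ℕ} (Goal : Subset n → Set) : Subset n → Subset n → Set where
  done  : ∀ {U C} → ∣ U ∣ ≤ 1 → Goal C → WaiterWins Goal U C
  offer : ∀ {U C} (x y : Fin n) → x ∈ U → y ∈ U → x ≢ y
        → WaiterWins Goal (U - x - y) (C ∪ ⁅ x ⁆)
        → WaiterWins Goal (U - x - y) (C ∪ ⁅ y ⁆)
        → WaiterWins Goal U C

WaiterHasStrategy : (n : ℕ) → (Subset n → Set) → Set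
WaiterHasStrategy n Goal = WaiterWins Goal ⊤ ⊥

ClientGetsHundredth : {n : ℕ} → List (Subset n) → Subset n → Set
ClientGetsHundredth F C = All (λ f → ∣ f ∣ ≤ 100 * ∣ C ∩ f ∣) F

-- Potential argument in the style of Erdős–Selfridge.  Give each hyperedge f the
-- weight 2ⁿ (1/2)^∣C ∩ f∣ (3/2)^∣W ∩ f∣, where C and W are Client's and Waiter's
-- elements, and let Φ be the total weight.  If Client keeps x and Waiter takes y,
-- Φ grows by at most (deg y − deg x)/2, where deg z is the weight of the edges
-- through z.  By pigeonhole, two of the ∣U∣ unclaimed elements have degrees within
-- Φ/(∣U∣−1) of each other; offering them costs a factor ∣U∣/(∣U∣−1) at most, and as
-- ∣U∣ drops by 2 per round, Φ ends below (n+1)∣F∣2ⁿ.  An edge where Client has fewer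
-- than ∣f∣/100 elements would alone weigh more than that once 2^∣f∣ > (3(n+1)∣F∣)²,
-- which follows from ∣f∣ ≥ log³n and ∣F∣ ≤ n^(log n) when n ≥ 16.

module Submission where

open import Defs
open import Data.Bool using (Bool; true; false; if_then_else_)
open import Data.Bool.Properties using (∨-zeroʳ; ∨-identityʳ)
open import Data.Empty using (⊥-elim)
open import Data.Fin using (Fin; zero; suc; fromℕ<; lift)
open import Data.Fin.Properties as Finₚ using (pigeonhole; fromℕ<-injective; lift-injective)
open import Data.Fin.Subset
  using (Subset; ∣_∣; _∈_; _∉_; _⊆_; _⊂_; ⊤; ⊥; _∩_; _∪_; _─_; _-_; ⁅_⁆; inside; outside)
open import Data.Fin.Subset.Induction using (⊂-wellFounded)
open import Data.Fin.Subset.Properties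
  using ( ∉⊥; ∣⊤∣≡n; x∈⁅y⁆⇒x≡y; ∩-comm; ∣p∩q∣≤∣q∣; ∪-identityʳ; x∈p∪q⁻; p─⊥≡p; p─q⊆p
        ; x∈p∧x≢y⇒x∈p-y; p─x─y≡p─y─x; x∈p⇒p-x⊂p; x∈p⇒∣p-x∣<∣p∣; ⊆-⊂-trans )
open import Data.List using (List; []; _∷_; length; map)
open import Data.List.Relation.Unary.All as All using (All; []; _∷_)
open import Data.Nat
  using (ℕ; zero; suc; _+_; _*_; _∸_; _^_; _≤_; _<_; z≤n; s≤s; s≤s⁻¹; z<s; NonZero; >-nonZero; _≤?_; _<?_)
open import Data.Nat.DivMod using (_/_; _%_; m%n≡m∸m/n*n; m%n<n; m/n*n≤m; m<n*o⇒m/o<n)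
open import Data.Nat.ListAction using (sum)
open import Data.Nat.Properties
open import Algebra.Properties.CommutativeSemigroup *-commutativeSemigroup using (interchange; x∙yz≈y∙xz)
open import Data.Nat.Tactic.RingSolver using (solve-∀)
open import Data.Product using (∃-syntax; ∃₂; _×_; _,_)
open import Data.Sum using (inj₁; inj₂)
open import Data.Vec using ([]; _∷_; here; there; lookup)
open import Function using (_∘_)
open import Function.Definitions using (Injective)
open import Induction.WellFounded using (Acc; acc)
open import Relation.Binary.PropositionalEquality
open import Relation.Nullary using (yes; no)

^-distribʳ-* : ∀ m n o → (m * n) ^ o ≡ m ^ o * n ^ o
^-distribʳ-* m n zero    = refl
^-distribʳ-* m n (suc o) = begin
  m * n * (m * n) ^ o     ≡⟨ cong (m * n *_) (^-distribʳ-* m n o) ⟩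
  m * n * (m ^ o * n ^ o) ≡⟨ interchange m n (m ^ o) (n ^ o) ⟩
  m * m ^ o * (n * n ^ o) ∎
  where open ≡-Reasoning

a^k*b^c≤b^k : ∀ {a b d c k} → a ≤ b → a ^ d * b ≤ b ^ d → d * c ≤ k → a ^ k * b ^ c ≤ b ^ k
a^k*b^c≤b^k {a} {b} {d} {c} {k} a≤b aᵈb≤bᵈ dc≤k =
  subst (λ e → a ^ e * b ^ c ≤ b ^ e) (trans (cong (_+ (k ∸ d * c)) (*-comm c d)) (m+[n∸m]≡n dc≤k))
    (go c (k ∸ d * c))
  where
  open ≤-Reasoning
  go : ∀ c m → a ^ (c * d + m) * b ^ c ≤ b ^ (c * d + m)
  go zero    m = begin
    a ^ m * 1 ≡⟨ *-identityʳ (a ^ m) ⟩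
    a ^ m     ≤⟨ ^-monoˡ-≤ m a≤b ⟩
    b ^ m     ∎
  go (suc c) m = begin
    a ^ (d + c * d + m) * (b * b ^ c)          ≡⟨ cong (λ e → a ^ e * (b * b ^ c)) (+-assoc d (c * d) m) ⟩
    a ^ (d + (c * d + m)) * (b * b ^ c)        ≡⟨ cong (_* (b * b ^ c)) (^-distribˡ-+-* a d (c * d + m)) ⟩
    a ^ d * a ^ (c * d + m) * (b * b ^ c)      ≡⟨ interchange (a ^ d) (a ^ (c * d + m)) b (b ^ c) ⟩
    a ^ d * b * (a ^ (c * d + m) * b ^ c)      ≤⟨ *-mono-≤ aᵈb≤bᵈ (go c m) ⟩
    b ^ d * b ^ (c * d + m)                    ≡⟨ ^-distribˡ-+-* b d (c * d + m) ⟨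
    b ^ (d + (c * d + m))                      ≡⟨ cong (b ^_) (+-assoc d (c * d) m) ⟨
    b ^ (d + c * d + m)                        ∎

[m/o]≡[n/o]⇒m∸n<o : ∀ m n o .{{_ : NonZero o}} → m / o ≡ n / o → m ∸ n < o
[m/o]≡[n/o]⇒m∸n<o m n o m/o≡n/o = begin-strict
  m ∸ n           ≤⟨ ∸-monoʳ-≤ m (m/n*n≤m n o) ⟩
  m ∸ n / o * o   ≡⟨ cong (λ q → m ∸ q * o) m/o≡n/o ⟨
  m ∸ m / o * o   ≡⟨ m%n≡m∸m/n*n m o ⟨
  m % o           <⟨ m%n<n m o ⟩
  o               ∎
  where open ≤-Reasoning

n<2^n : ∀ n → n < 2 ^ n
n<2^n zero    = s≤s z≤n
n<2^n (suc n) = +-mono-≤ (m^n>0 2 n) (≤-trans (n<2^n n) (m≤m+n (2 ^ n) 0))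

log₂-bracket : ∀ n → 0 < n → ∃[ p ] 2 ^ p ≤ n × n < 2 ^ suc p
log₂-bracket n 0<n = search n (n<2^n n)
  where
  search : ∀ b → n < 2 ^ b → ∃[ p ] 2 ^ p ≤ n × n < 2 ^ suc p
  search zero    n<1 = ⊥-elim (<-irrefl refl (<-≤-trans n<1 0<n))
  search (suc b) n<2^[1+b] with n <? 2 ^ b
  ... | yes n<2^b = search b n<2^b
  ... | no  n≮2^b = b , ≮⇒≥ n≮2^b , n<2^[1+b]

module _ {a} {A : Set a} where

  sum-map-mono : ∀ {f g : A → ℕ} (xs : List A) → (∀ x → f x ≤ g x) → sum (map f xs) ≤ sum (map g xs)
  sum-map-mono []       f≤g = z≤n
  sum-map-mono (x ∷ xs) f≤g = +-mono-≤ (f≤g x) (sum-map-mono xs f≤g)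

  All-≤-sum-map : ∀ (g : A → ℕ) xs → All (λ x → g x ≤ sum (map g xs)) xs
  All-≤-sum-map g []       = []
  All-≤-sum-map g (x ∷ xs) = m≤m+n (g x) _ ∷ All.map (λ le → ≤-trans le (m≤n+m _ (g x))) (All-≤-sum-map g xs)

  sum-map-linear : ∀ k l (f g : A → ℕ) (xs : List A) →
                   sum (map (λ x → k * f x + l * g x) xs) ≡ k * sum (map f xs) + l * sum (map g xs)
  sum-map-linear k l f g []       = sym (cong₂ _+_ (*-zeroʳ k) (*-zeroʳ l))
  sum-map-linear k l f g (x ∷ xs) = trans (cong (k * f x + l * g x +_) (sum-map-linear k l f g xs))
                                          (distrib k l (f x) (g x) (sum (map f xs)) (sum (map g xs)))
    where
    distrib : ∀ k l a b s t → k * a + l * b + (k * s + l * t) ≡ k * (a + s) + l * (b + t)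
    distrib = solve-∀

-- Subsets and the pigeonhole principle

module _ {n : ℕ} where

  Disjoint : Subset n → Subset n → Set
  Disjoint p q = ∀ {x} → x ∈ p → x ∉ q

  disjoint-⊆ : ∀ {p q r : Subset n} → r ⊆ p → Disjoint p q → Disjoint r q
  disjoint-⊆ r⊆p p∩q≡∅ x∈r = p∩q≡∅ (r⊆p x∈r)

x∈p─q⇒x∉q : ∀ {n} {p q : Subset n} {x} → x ∈ p ─ q → x ∉ q
x∈p─q⇒x∉q {p = _ ∷ _} {q = outside ∷ _} here          ()
x∈p─q⇒x∉q {p = _ ∷ _} {q = _ ∷ _}       (there x∈p─q) (there x∈q) = x∈p─q⇒x∉q x∈p─q x∈q

disjoint-claim : ∀ {n} {p q : Subset n} x → Disjoint p q → Disjoint (p - x) (q ∪ ⁅ x ⁆)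
disjoint-claim {p = p} {q} x p∩q≡∅ z∈p-x z∈q∪⁅x⁆ with x∈p∪q⁻ q ⁅ x ⁆ z∈q∪⁅x⁆
... | inj₁ z∈q   = p∩q≡∅ (p─q⊆p p ⁅ x ⁆ z∈p-x) z∈q
... | inj₂ z∈⁅x⁆ = x∈p─q⇒x∉q z∈p-x z∈⁅x⁆

enumerate : ∀ {n} (p : Subset n) → ∃[ e ] (Injective {A = Fin ∣ p ∣} _≡_ _≡_ e × ∀ i → e i ∈ p)
enumerate []            = (λ ()) , (λ {}) , (λ ())
enumerate (outside ∷ p) with e , e-injective , e∈p ← enumerate p =
  suc ∘ e , e-injective ∘ Finₚ.suc-injective , there ∘ e∈p
enumerate (inside ∷ p)  with e , e-injective , e∈p ← enumerate p =
  lift 1 e , lift-injective e e-injective 1 , e∈inside∷p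
  where
  e∈inside∷p : ∀ i → lift 1 e i ∈ inside ∷ p
  e∈inside∷p zero    = here
  e∈inside∷p (suc i) = there (e∈p i)

subset-pigeonhole : ∀ {m n} (p : Subset n) (h : Fin n → Fin m) → m < ∣ p ∣ →
                    ∃₂ λ x y → x ∈ p × y ∈ p × x ≢ y × h x ≡ h y
subset-pigeonhole p h m<∣p∣ with e , e-injective , e∈p ← enumerate p
                              with i , j , i<j , hei≡hej ← pigeonhole m<∣p∣ (h ∘ e) =
  e i , e j , e∈p i , e∈p j , Finₚ.<⇒≢ i<j ∘ e-injective , hei≡hej

close-pair : ∀ {n} (p : Subset n) (g : Fin n → ℕ) M r .{{_ : NonZero r}} → r < ∣ p ∣ → (∀ x → g x ≤ M) →
             ∃₂ λ x y → x ∈ p × y ∈ p × x ≢ y × r * (g x ∸ g y) ≤ M × r * (g y ∸ g x) ≤ M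
close-pair {n} p g M r r<∣p∣ g≤M =
  let x , y , x∈p , y∈p , x≢y , bx≡by = subset-pigeonhole p bucket r<∣p∣
  in  x , y , x∈p , y∈p , x≢y , close x y bx≡by , close y x (sym bx≡by)
  where
  bucket< : ∀ x → r * g x / suc M < r
  bucket< x = m<n*o⇒m/o<n (*-monoʳ-< r (s≤s (g≤M x)))
  bucket : Fin n → Fin r
  bucket x = fromℕ< (bucket< x)
  close : ∀ x y → bucket x ≡ bucket y → r * (g x ∸ g y) ≤ M
  close x y bx≡by = s≤s⁻¹ (subst (_< suc M) (sym (*-distribˡ-∸ r (g x) (g y)))
    ([m/o]≡[n/o]⇒m∸n<o (r * g x) (r * g y) (suc M) (fromℕ<-injective _ _ (bucket< x) (bucket< y) bx≡by)))

2+∣p-x-y∣≤∣p∣ : ∀ {n} {p : Subset n} {x y} → x ∈ p → y ∈ p → x ≢ y → 2 + ∣ p - x - y ∣ ≤ ∣ p ∣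
2+∣p-x-y∣≤∣p∣ x∈p y∈p x≢y = <-≤-trans (s≤s (x∈p⇒∣p-x∣<∣p∣ (x∈p∧x≢y⇒x∈p-y y∈p (x≢y ∘ sym)))) (x∈p⇒∣p-x∣<∣p∣ x∈p)

-- Waiter strategies from potentials

record BalancedOffer {n} (Φ : Subset n → Subset n → ℕ) (U C : Subset n) : Set where
  field
    x y    : Fin n
    x∈U    : x ∈ U
    y∈U    : y ∈ U
    x≢y    : x ≢ y
    keep-x : (∣ U ∣ ∸ 1) * Φ (U - x - y) (C ∪ ⁅ x ⁆) ≤ ∣ U ∣ * Φ U C
    keep-y : (∣ U ∣ ∸ 1) * Φ (U - x - y) (C ∪ ⁅ y ⁆) ≤ ∣ U ∣ * Φ U C

module PotentialStrategy {n} {Goal : Subset n → Set} (Φ : Subset n → Subset n → ℕ) (B : ℕ)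
  (goal : ∀ {U C} → ∣ U ∣ ≤ 1 → Φ U C ≤ B → Goal C)
  (balanced : ∀ {U C} → Disjoint U C → 2 ≤ ∣ U ∣ → BalancedOffer Φ U C) where

  -- As ∣U∣ drops by 2 per round, the growth bound keeps (1 + ∣U∣) Φ from increasing.
  invariant-step : ∀ {u u′ P P′} → 2 + u′ ≤ u → (u ∸ 1) * P′ ≤ u * P → suc u * P ≤ B → suc u′ * P′ ≤ B
  invariant-step {u} {u′} {P} {P′} 2+u′≤u growth inv = begin
    suc u′ * P′   ≤⟨ *-monoˡ-≤ P′ (∸-monoˡ-≤ 1 2+u′≤u) ⟩
    (u ∸ 1) * P′  ≤⟨ growth ⟩
    u * P         ≤⟨ *-monoˡ-≤ P (n≤1+n u) ⟩
    suc u * P     ≤⟨ inv ⟩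
    B             ∎
    where open ≤-Reasoning

  waiterWins : ∀ {U C} → Acc _⊂_ U → Disjoint U C → suc ∣ U ∣ * Φ U C ≤ B → WaiterWins Goal U C
  waiterWins {U} {C} (acc smaller) U∩C≡∅ inv with ∣ U ∣ ≤? 1
  ... | yes ∣U∣≤1 = done ∣U∣≤1 (goal ∣U∣≤1 (≤-trans (m≤n*m (Φ U C) (suc ∣ U ∣)) inv))
  ... | no  ∣U∣≰1 = offer x y x∈U y∈U x≢y
    (waiterWins (smaller shrinks) (disjoint-⊆ (p─q⊆p (U - x) ⁅ y ⁆) (disjoint-claim x U∩C≡∅))
                (invariant-step (2+∣p-x-y∣≤∣p∣ x∈U y∈U x≢y) keep-x inv))
    (waiterWins (smaller shrinks) (disjoint-⊆ U-x-y⊆U-y (disjoint-claim y U∩C≡∅))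
                (invariant-step (2+∣p-x-y∣≤∣p∣ x∈U y∈U x≢y) keep-y inv))
    where
    open BalancedOffer (balanced U∩C≡∅ (≰⇒> ∣U∣≰1))
    shrinks : U - x - y ⊂ U
    shrinks = ⊆-⊂-trans (p─q⊆p (U - x) ⁅ y ⁆) (x∈p⇒p-x⊂p x∈U)
    U-x-y⊆U-y : U - x - y ⊆ U - y
    U-x-y⊆U-y z∈U-x-y = p─q⊆p (U - y) ⁅ x ⁆ (subst (_ ∈_) (p─x─y≡p─y─x U x y) z∈U-x-y)

  waiterHasStrategy : suc n * Φ ⊤ ⊥ ≤ B → WaiterHasStrategy n Goal
  waiterHasStrategy inv = waiterWins (⊂-wellFounded ⊤) (λ _ → ∉⊥) (subst (λ u → suc u * Φ ⊤ ⊥ ≤ B) (sym (∣⊤∣≡n n)) inv)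

-- The weight potential

-- vertexWeight (x ∈ f) (x ∈ U) (x ∈ C); their product is 2ⁿ (1/2)^∣C ∩ f∣ (3/2)^∣W ∩ f∣.
vertexWeight : Bool → Bool → Bool → ℕ
vertexWeight false _     _     = 2
vertexWeight true  true  _     = 2
vertexWeight true  false true  = 1
vertexWeight true  false false = 3

weight : ∀ {n} → Subset n → Subset n → Subset n → ℕ
weight []      []      []      = 1
weight (a ∷ f) (u ∷ U) (c ∷ C) = vertexWeight a u c * weight f U C

clientFactor : Bool → ℕ
clientFactor true  = 1
clientFactor false = 2

waiterFactor : Bool → ℕ
waiterFactor true  = 3
waiterFactor false = 2

m*[p*w]≡q*[r*w] : ∀ {m p q r} w → m * p ≡ q * r → m * (p * w) ≡ q * (r * w)
m*[p*w]≡q*[r*w] {m} {p} {q} {r} w mp≡qr =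
  trans (sym (*-assoc m p w)) (trans (cong (_* w) mp≡qr) (*-assoc q r w))

m*[v*w]≡k*[v*w′] : ∀ {m k w w′} v → m * w ≡ k * w′ → m * (v * w) ≡ k * (v * w′)
m*[v*w]≡k*[v*w′] {m} {k} {w} {w′} v mw≡kw′ =
  trans (x∙yz≈y∙xz m v w) (trans (cong (v *_) mw≡kw′) (x∙yz≈y∙xz v k w′))

s∷p-zero≡outside∷p : ∀ {n} s (p : Subset n) → (s ∷ p) - zero ≡ outside ∷ p
s∷p-zero≡outside∷p s p = cong (outside ∷_) (p─⊥≡p p)

s∷p∪⁅zero⁆≡inside∷p : ∀ {n} s (p : Subset n) → (s ∷ p) ∪ ⁅ zero ⁆ ≡ inside ∷ p
s∷p∪⁅zero⁆≡inside∷p s p = cong₂ _∷_ (∨-zeroʳ s) (∪-identityʳ p)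

s∷p∪⁅suc-x⁆≡s∷[p∪⁅x⁆] : ∀ {n} s (p : Subset n) x → (s ∷ p) ∪ ⁅ suc x ⁆ ≡ s ∷ (p ∪ ⁅ x ⁆)
s∷p∪⁅suc-x⁆≡s∷[p∪⁅x⁆] s p x = cong (_∷ _) (∨-identityʳ s)

weight-clientClaim : ∀ {n} (f : Subset n) {U C x} → x ∈ U →
                     2 * weight f (U - x) (C ∪ ⁅ x ⁆) ≡ clientFactor (lookup f x) * weight f U C
weight-clientClaim (a ∷ f) {inside ∷ U} {c ∷ C} here =
  trans (cong₂ (λ V D → 2 * weight (a ∷ f) V D) (s∷p-zero≡outside∷p inside U) (s∷p∪⁅zero⁆≡inside∷p c C))
        (m*[p*w]≡q*[r*w] {m = 2} {vertexWeight a false true} {clientFactor a} (weight f U C) (claim a))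
  where
  claim : ∀ a → 2 * vertexWeight a false true ≡ clientFactor a * vertexWeight a true c
  claim false = refl
  claim true  = refl
weight-clientClaim (a ∷ f) {u ∷ U} {c ∷ C} {suc x} (there x∈U) =
  trans (cong (λ D → 2 * weight (a ∷ f) (u ∷ (U - x)) D) (s∷p∪⁅suc-x⁆≡s∷[p∪⁅x⁆] c C x))
        (m*[v*w]≡k*[v*w′] {m = 2} {k = clientFactor (lookup f x)} (vertexWeight a u c) (weight-clientClaim f x∈U))

weight-waiterClaim : ∀ {n} (f : Subset n) {U C x} → x ∈ U → x ∉ C →
                     2 * weight f (U - x) C ≡ waiterFactor (lookup f x) * weight f U C
weight-waiterClaim (a ∷ f) {inside ∷ U} {inside ∷ C} here x∉C = ⊥-elim (x∉C here)
weight-waiterClaim (a ∷ f) {inside ∷ U} {outside ∷ C} here x∉C =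
  trans (cong (λ V → 2 * weight (a ∷ f) V (outside ∷ C)) (s∷p-zero≡outside∷p inside U))
        (m*[p*w]≡q*[r*w] {m = 2} {vertexWeight a false false} {waiterFactor a} (weight f U C) (claim a))
  where
  claim : ∀ a → 2 * vertexWeight a false false ≡ waiterFactor a * vertexWeight a true false
  claim false = refl
  claim true  = refl
weight-waiterClaim (a ∷ f) {u ∷ U} {c ∷ C} {suc x} (there x∈U) x∉C =
  m*[v*w]≡k*[v*w′] {m = 2} {k = waiterFactor (lookup f x)} (vertexWeight a u c) (weight-waiterClaim f x∈U (x∉C ∘ there))

weight-round : ∀ {n} (f : Subset n) {U C x y} → x ∈ U → y ∈ U → x ≢ y → y ∉ C →
               4 * weight f (U - x - y) (C ∪ ⁅ x ⁆)
                 ≡ waiterFactor (lookup f y) * (clientFactor (lookup f x) * weight f U C)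
weight-round f {U} {C} {x} {y} x∈U y∈U x≢y y∉C = begin
  4 * w₂                                   ≡⟨ *-assoc 2 2 w₂ ⟩
  2 * (2 * w₂)                             ≡⟨ cong (2 *_) (weight-waiterClaim f y∈U-x y∉C∪⁅x⁆) ⟩
  2 * (k * w₁)                             ≡⟨ x∙yz≈y∙xz 2 k w₁ ⟩
  k * (2 * w₁)                             ≡⟨ cong (k *_) (weight-clientClaim f x∈U) ⟩
  k * (clientFactor (lookup f x) * weight f U C) ∎
  where
  open ≡-Reasoning
  w₁ = weight f (U - x) (C ∪ ⁅ x ⁆)
  w₂ = weight f (U - x - y) (C ∪ ⁅ x ⁆)
  k  = waiterFactor (lookup f y)
  y∈U-x : y ∈ U - x
  y∈U-x = x∈p∧x≢y⇒x∈p-y y∈U (x≢y ∘ sym)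
  y∉C∪⁅x⁆ : y ∉ C ∪ ⁅ x ⁆
  y∉C∪⁅x⁆ y∈C∪⁅x⁆ with x∈p∪q⁻ C ⁅ x ⁆ y∈C∪⁅x⁆
  ... | inj₁ y∈C   = y∉C y∈C
  ... | inj₂ y∈⁅x⁆ = x≢y (sym (x∈⁅y⁆⇒x≡y x y∈⁅x⁆))

claimFactors-bound : ∀ a b w → waiterFactor b * (clientFactor a * w) + 2 * (if a then w else 0)
                                 ≤ 4 * w + 2 * (if b then w else 0)
claimFactors-bound true  true  w = ≤-trans (m≤m+n _ w) (≤-reflexive (both w))
  where
  both : ∀ w → 3 * (1 * w) + 2 * w + w ≡ 4 * w + 2 * w
  both = solve-∀
claimFactors-bound true  false w = ≤-reflexive (client w)
  where
  client : ∀ w → 2 * (1 * w) + 2 * w ≡ 4 * w + 2 * 0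
  client = solve-∀
claimFactors-bound false true  w = ≤-reflexive (waiter w)
  where
  waiter : ∀ w → 3 * (2 * w) + 2 * 0 ≡ 4 * w + 2 * w
  waiter = solve-∀
claimFactors-bound false false w = ≤-reflexive (neither w)
  where
  neither : ∀ w → 2 * (2 * w) + 2 * 0 ≡ 4 * w + 2 * 0
  neither = solve-∀

incidentWeight : ∀ {n} → Subset n → Subset n → Subset n → Fin n → ℕ
incidentWeight f U C x = if lookup f x then weight f U C else 0

incidentWeight≤weight : ∀ {n} (f U C : Subset n) x → incidentWeight f U C x ≤ weight f U C
incidentWeight≤weight f U C x with lookup f x
... | true  = ≤-refl
... | false = z≤n

module _ {n : ℕ} (F : List (Subset n)) where

  potential : Subset n → Subset n → ℕ
  potential U C = sum (map (λ f → weight f U C) F)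

  degree : Subset n → Subset n → Fin n → ℕ
  degree U C x = sum (map (λ f → incidentWeight f U C x) F)

  degree≤potential : ∀ U C x → degree U C x ≤ potential U C
  degree≤potential U C x = sum-map-mono F (λ f → incidentWeight≤weight f U C x)

  potential-round : ∀ {U C x y} → Disjoint U C → x ∈ U → y ∈ U → x ≢ y →
    4 * potential (U - x - y) (C ∪ ⁅ x ⁆) + 2 * degree U C x ≤ 4 * potential U C + 2 * degree U C y
  potential-round {U} {C} {x} {y} U∩C≡∅ x∈U y∈U x≢y = begin
    4 * potential (U - x - y) (C ∪ ⁅ x ⁆) + 2 * degree U C x
      ≡⟨ sum-map-linear 4 2 (λ f → weight f (U - x - y) (C ∪ ⁅ x ⁆)) (λ f → incidentWeight f U C x) F ⟨
    sum (map (λ f → 4 * weight f (U - x - y) (C ∪ ⁅ x ⁆) + 2 * incidentWeight f U C x) F)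
      ≤⟨ sum-map-mono F per-edge ⟩
    sum (map (λ f → 4 * weight f U C + 2 * incidentWeight f U C y) F)
      ≡⟨ sum-map-linear 4 2 (λ f → weight f U C) (λ f → incidentWeight f U C y) F ⟩
    4 * potential U C + 2 * degree U C y ∎
    where
    open ≤-Reasoning
    per-edge : ∀ f → 4 * weight f (U - x - y) (C ∪ ⁅ x ⁆) + 2 * incidentWeight f U C x
                   ≤ 4 * weight f U C + 2 * incidentWeight f U C y
    per-edge f rewrite weight-round f x∈U y∈U x≢y (U∩C≡∅ y∈U) =
      claimFactors-bound (lookup f x) (lookup f y) (weight f U C)

potential-growth : ∀ u {P P′ Dx Dy} → 4 * P′ + 2 * Dx ≤ 4 * P + 2 * Dy → (u ∸ 1) * (Dy ∸ Dx) ≤ P →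
                   (u ∸ 1) * P′ ≤ u * P
potential-growth zero    _     _     = z≤n
potential-growth (suc r) {P} {P′} {Dx} {Dy} round close = *-cancelˡ-≤ 4 (begin
  4 * (r * P′)                    ≡⟨ x∙yz≈y∙xz 4 r P′ ⟩
  r * (4 * P′)                    ≤⟨ *-monoʳ-≤ r without-Dx ⟩
  r * (4 * P + 2 * (Dy ∸ Dx))     ≡⟨ distrib r P (Dy ∸ Dx) ⟩
  r * (4 * P) + 2 * (r * (Dy ∸ Dx)) ≤⟨ +-monoʳ-≤ (r * (4 * P)) (*-mono-≤ (≤ᵇ⇒≤ 2 4 _) close) ⟩
  r * (4 * P) + 4 * P             ≡⟨ collect r P ⟩
  4 * (suc r * P)                 ∎)
  where
  open ≤-Reasoning
  distrib : ∀ r P d → r * (4 * P + 2 * d) ≡ r * (4 * P) + 2 * (r * d)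
  distrib = solve-∀
  collect : ∀ r P → r * (4 * P) + 4 * P ≡ 4 * (P + r * P)
  collect = solve-∀
  without-Dx : 4 * P′ ≤ 4 * P + 2 * (Dy ∸ Dx)
  without-Dx = +-cancelʳ-≤ (2 * Dx) _ _ (begin
    4 * P′ + 2 * Dx                    ≤⟨ round ⟩
    4 * P + 2 * Dy                     ≤⟨ +-monoʳ-≤ (4 * P) (*-monoʳ-≤ 2 (m≤n+m∸n Dy Dx)) ⟩
    4 * P + 2 * (Dx + (Dy ∸ Dx))       ≡⟨ shift P Dx (Dy ∸ Dx) ⟩
    4 * P + 2 * (Dy ∸ Dx) + 2 * Dx     ∎)
    where
    shift : ∀ P a d → 4 * P + 2 * (a + d) ≡ 4 * P + 2 * d + 2 * a
    shift = solve-∀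

balancedOffer : ∀ {n} (F : List (Subset n)) {U C} → Disjoint U C → 2 ≤ ∣ U ∣ → BalancedOffer (potential F) U C
balancedOffer F {U} {C} U∩C≡∅ 2≤∣U∣ =
  let x , y , x∈U , y∈U , x≢y , Dx∸Dy≤Φ , Dy∸Dx≤Φ = close-pair U (degree F U C) (potential F U C) (∣ U ∣ ∸ 1)
        {{>-nonZero (m<n⇒0<n∸m 2≤∣U∣)}} (∸-monoʳ-< z<s (<⇒≤ 2≤∣U∣)) (degree≤potential F U C)
  in record
    { x      = x
    ; y      = y
    ; x∈U    = x∈U
    ; y∈U    = y∈U
    ; x≢y    = x≢y
    ; keep-x = potential-growth ∣ U ∣ {Dx = degree F U C x} {Dy = degree F U C y}
                 (potential-round F U∩C≡∅ x∈U y∈U x≢y) Dy∸Dx≤Φ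
    ; keep-y = potential-growth ∣ U ∣ {Dx = degree F U C y} {Dy = degree F U C x}
                 (subst (λ V → 4 * potential F V (C ∪ ⁅ y ⁆) + 2 * degree F U C y
                             ≤ 4 * potential F U C + 2 * degree F U C x)
                        (p─x─y≡p─y─x U y x) (potential-round F U∩C≡∅ y∈U x∈U (x≢y ∘ sym)))
                 Dx∸Dy≤Φ
    }

weight-⊤-⊥ : ∀ {n} (f : Subset n) → weight f ⊤ ⊥ ≡ 2 ^ n
weight-⊤-⊥ []            = refl
weight-⊤-⊥ (inside ∷ f)  = cong (2 *_) (weight-⊤-⊥ f)
weight-⊤-⊥ (outside ∷ f) = cong (2 *_) (weight-⊤-⊥ f)

potential-⊤-⊥ : ∀ {n} (F : List (Subset n)) → potential F ⊤ ⊥ ≡ length F * 2 ^ n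
potential-⊤-⊥ []      = refl
potential-⊤-⊥ (f ∷ F) = cong₂ _+_ (weight-⊤-⊥ f) (potential-⊤-⊥ F)

rescale : ∀ {L R L′ R′} s t → L′ ≡ s * L → t * R ≡ R′ → s ≤ t → L ≤ R → L′ ≤ R′
rescale s t L′≡sL tR≡R′ s≤t L≤R = ≤-trans (≤-reflexive L′≡sL) (≤-trans (*-mono-≤ s≤t L≤R) (≤-reflexive tR≡R′))

weight-lowerBound : ∀ {n} (f U C : Subset n) →
                    2 ^ n * 3 ^ ∣ f ∣ ≤ weight f U C * (2 ^ ∣ f ∣ * (3 ^ ∣ f ∩ C ∣ * 3 ^ ∣ f ∩ U ∣))
weight-lowerBound = go
  where
  in-f : ∀ N K → 2 * N * (3 * K) ≡ 6 * (N * K)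
  in-f = solve-∀
  unclaimed-client : ∀ W P c u → 36 * (W * (P * (c * u))) ≡ 2 * W * (2 * P * (3 * c * (3 * u)))
  unclaimed-client = solve-∀
  unclaimed : ∀ W P c u → 12 * (W * (P * (c * u))) ≡ 2 * W * (2 * P * (c * (3 * u)))
  unclaimed = solve-∀
  client : ∀ W P c u → 6 * (W * (P * (c * u))) ≡ 1 * W * (2 * P * (3 * c * u))
  client = solve-∀
  waiter : ∀ W P c u → 6 * (W * (P * (c * u))) ≡ 3 * W * (2 * P * (c * u))
  waiter = solve-∀
  go : ∀ {n} (f U C : Subset n) →
       2 ^ n * 3 ^ ∣ f ∣ ≤ weight f U C * (2 ^ ∣ f ∣ * (3 ^ ∣ f ∩ C ∣ * 3 ^ ∣ f ∩ U ∣))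
  go []      []      []      = ≤-refl
  go {suc n} (outside ∷ f) (u ∷ U) (c ∷ C) =
    rescale 2 2 (*-assoc 2 (2 ^ n) (3 ^ ∣ f ∣))
      (sym (*-assoc 2 (weight f U C) (2 ^ ∣ f ∣ * (3 ^ ∣ f ∩ C ∣ * 3 ^ ∣ f ∩ U ∣)))) ≤-refl (go f U C)
  go {suc n} (inside ∷ f) (inside ∷ U) (inside ∷ C) =
    rescale 6 36 (in-f (2 ^ n) (3 ^ ∣ f ∣))
      (unclaimed-client (weight f U C) (2 ^ ∣ f ∣) (3 ^ ∣ f ∩ C ∣) (3 ^ ∣ f ∩ U ∣))
      (≤ᵇ⇒≤ 6 36 _) (go f U C)
  go {suc n} (inside ∷ f) (inside ∷ U) (outside ∷ C) =
    rescale 6 12 (in-f (2 ^ n) (3 ^ ∣ f ∣))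
      (unclaimed (weight f U C) (2 ^ ∣ f ∣) (3 ^ ∣ f ∩ C ∣) (3 ^ ∣ f ∩ U ∣))
      (≤ᵇ⇒≤ 6 12 _) (go f U C)
  go {suc n} (inside ∷ f) (outside ∷ U) (inside ∷ C) =
    rescale 6 6 (in-f (2 ^ n) (3 ^ ∣ f ∣))
      (client (weight f U C) (2 ^ ∣ f ∣) (3 ^ ∣ f ∩ C ∣) (3 ^ ∣ f ∩ U ∣))
      ≤-refl (go f U C)
  go {suc n} (inside ∷ f) (outside ∷ U) (outside ∷ C) =
    rescale 6 6 (in-f (2 ^ n) (3 ^ ∣ f ∣))
      (waiter (weight f U C) (2 ^ ∣ f ∣) (3 ^ ∣ f ∩ C ∣) (3 ^ ∣ f ∩ U ∣))
      ≤-refl (go f U C)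

3^k≤X*2^k*3^c⇒k<100*c : ∀ {X k c} → X * X < 2 ^ k → 3 ^ k ≤ X * 2 ^ k * 3 ^ c → k < 100 * c
3^k≤X*2^k*3^c⇒k<100*c {X} {k} {c} X²<2ᵏ 3ᵏ≤X2ᵏ3ᶜ with 100 * c ≤? k
... | no  100c≰k = ≰⇒> 100c≰k
... | yes 100c≤k = ⊥-elim (<-irrefl refl (begin-strict
  3 ^ k * 3 ^ k                                   ≤⟨ *-mono-≤ 3ᵏ≤X2ᵏ3ᶜ 3ᵏ≤X2ᵏ3ᶜ ⟩
  X * 2 ^ k * 3 ^ c * (X * 2 ^ k * 3 ^ c)         ≡⟨ regroup X (2 ^ k) (3 ^ c) ⟩
  X * X * (2 ^ k * 2 ^ k * (3 ^ c * 3 ^ c))       <⟨ *-monoˡ-< _ {{R≢0}} X²<2ᵏ ⟩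
  2 ^ k * (2 ^ k * 2 ^ k * (3 ^ c * 3 ^ c))       ≡⟨ as-powers ⟩
  8 ^ k * 9 ^ c                                   ≤⟨ a^k*b^c≤b^k {d = 100} {c = c} 8≤9 8¹⁰⁰9≤9¹⁰⁰ 100c≤k ⟩
  9 ^ k                                           ≡⟨ ^-distribʳ-* 3 3 k ⟩
  3 ^ k * 3 ^ k                                   ∎))
  where
  open ≤-Reasoning
  8≤9 : 8 ≤ 9
  8≤9 = ≤ᵇ⇒≤ 8 9 _
  8¹⁰⁰9≤9¹⁰⁰ : 8 ^ 100 * 9 ≤ 9 ^ 100
  8¹⁰⁰9≤9¹⁰⁰ = ≤ᵇ⇒≤ (8 ^ 100 * 9) (9 ^ 100) _
  regroup : ∀ x t u → x * t * u * (x * t * u) ≡ x * x * (t * t * (u * u))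
  regroup = solve-∀
  R≢0 : NonZero (2 ^ k * 2 ^ k * (3 ^ c * 3 ^ c))
  R≢0 = m*n≢0 _ _ {{m*n≢0 _ _ {{m^n≢0 2 k}} {{m^n≢0 2 k}}}} {{m*n≢0 _ _ {{m^n≢0 3 c}} {{m^n≢0 3 c}}}}
  as-powers : 2 ^ k * (2 ^ k * 2 ^ k * (3 ^ c * 3 ^ c)) ≡ 8 ^ k * 9 ^ c
  as-powers = begin-equality
    2 ^ k * (2 ^ k * 2 ^ k * (3 ^ c * 3 ^ c))   ≡⟨ *-assoc (2 ^ k) _ _ ⟨
    2 ^ k * (2 ^ k * 2 ^ k) * (3 ^ c * 3 ^ c)
      ≡⟨ cong₂ (λ s t → 2 ^ k * s * t) (^-distribʳ-* 2 2 k) (^-distribʳ-* 3 3 c) ⟨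
    2 ^ k * 4 ^ k * 9 ^ c                       ≡⟨ cong (_* 9 ^ c) (^-distribʳ-* 2 4 k) ⟨
    8 ^ k * 9 ^ c                               ∎

light-weight⇒hundredth : ∀ {n} K (f U C : Subset n) → ∣ U ∣ ≤ 1 → weight f U C ≤ K * 2 ^ n →
              3 * K * (3 * K) < 2 ^ ∣ f ∣ → ∣ f ∣ ≤ 100 * ∣ C ∩ f ∣
light-weight⇒hundredth {n} K f U C ∣U∣≤1 w≤K2ⁿ X²<2ᵏ =
  subst (λ c → ∣ f ∣ ≤ 100 * c) (cong ∣_∣ (∩-comm f C))
    (<⇒≤ (3^k≤X*2^k*3^c⇒k<100*c {X = 3 * K} {c = ∣ f ∩ C ∣} X²<2ᵏ 3ᵏ≤X2ᵏ3ᶜ))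
  where
  open ≤-Reasoning
  regroup : ∀ K N P c → K * N * (P * (c * (3 * 1))) ≡ N * (3 * K * P * c)
  regroup = solve-∀
  3ᵏ≤X2ᵏ3ᶜ : 3 ^ ∣ f ∣ ≤ 3 * K * 2 ^ ∣ f ∣ * 3 ^ ∣ f ∩ C ∣
  3ᵏ≤X2ᵏ3ᶜ = *-cancelˡ-≤ (2 ^ n) {{m^n≢0 2 n}} (begin
    2 ^ n * 3 ^ ∣ f ∣                                          ≤⟨ weight-lowerBound f U C ⟩
    weight f U C * (2 ^ ∣ f ∣ * (3 ^ ∣ f ∩ C ∣ * 3 ^ ∣ f ∩ U ∣)) ≤⟨ *-mono-≤ w≤K2ⁿ (*-monoʳ-≤ (2 ^ ∣ f ∣)
                                                                    (*-monoʳ-≤ (3 ^ ∣ f ∩ C ∣)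
                                                                      (^-monoʳ-≤ 3 (≤-trans (∣p∩q∣≤∣q∣ f U) ∣U∣≤1)))) ⟩
    K * 2 ^ n * (2 ^ ∣ f ∣ * (3 ^ ∣ f ∩ C ∣ * 3 ^ 1))          ≡⟨ regroup K (2 ^ n) (2 ^ ∣ f ∣) (3 ^ ∣ f ∩ C ∣) ⟩
    2 ^ n * (3 * K * 2 ^ ∣ f ∣ * 3 ^ ∣ f ∩ C ∣)                ∎)

waiterForcesHundredth : ∀ {n} (F : List (Subset n)) → let X = 3 * (suc n * length F) in
                        All (λ f → X * X < 2 ^ ∣ f ∣) F → WaiterHasStrategy n (ClientGetsHundredth F)
waiterForcesHundredth {n} F large =
  waiterHasStrategy (≤-reflexive (trans (cong (suc n *_) (potential-⊤-⊥ F)) (sym (*-assoc (suc n) (length F) (2 ^ n)))))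
  where
  K = suc n * length F
  final : ∀ {U C} → ∣ U ∣ ≤ 1 → potential F U C ≤ K * 2 ^ n → ClientGetsHundredth F C
  final {U} {C} ∣U∣≤1 Φ≤K2ⁿ = All.zipWith
    (λ {f} (X²<2ᵏ , w≤Φ) → light-weight⇒hundredth K f U C ∣U∣≤1 (≤-trans w≤Φ Φ≤K2ⁿ) X²<2ᵏ)
    (large , All-≤-sum-map (λ f → weight f U C) F)
  open PotentialStrategy (potential F) (K * 2 ^ n) final (balancedOffer F)

-- The logarithmic hypotheses

Log₂Cubed≤⇒^3≤ : ∀ {n k p} → Log₂Cubed≤ n k → 2 ^ p ≤ n → p ^ 3 ≤ k
Log₂Cubed≤⇒^3≤ {n} {k} {p} log₂³n≤k 2ᵖ≤n = ≮⇒≥ λ k<p³ →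
  <⇒≱ (log₂³n≤k p 1 z<s (subst (_< p ^ 3) (sym (*-identityʳ k)) k<p³))
      (subst (2 ^ p ≤_) (sym (*-identityʳ n)) 2ᵖ≤n)

≤PowLog₂⇒<2^[P*P] : ∀ {n m P} → ≤PowLog₂ n m → n < 2 ^ P → m < 2 ^ (P * P)
≤PowLog₂⇒<2^[P*P] {n} {m} {P} m≤n^log₂n n<2ᴾ =
  subst (_< 2 ^ (P * P)) (*-identityʳ m) (m≤n^log₂n P 1 z<s (subst (_< 2 ^ P) (sym (*-identityʳ n)) n<2ᴾ))

3[1+n]m<2^[2+P+P*P] : ∀ {n m P} → n < 2 ^ P → m < 2 ^ (P * P) → 3 * (suc n * m) < 2 ^ (2 + P + P * P)
3[1+n]m<2^[2+P+P*P] {n} {m} {P} n<2ᴾ m<2ᴾᴾ = begin-strict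
  3 * (suc n * m)             ≤⟨ *-monoʳ-≤ 3 (*-monoˡ-≤ m n<2ᴾ) ⟩
  3 * (2 ^ P * m)             <⟨ *-monoʳ-< 3 (*-monoʳ-< (2 ^ P) {{m^n≢0 2 P}} m<2ᴾᴾ) ⟩
  3 * (2 ^ P * 2 ^ (P * P))   ≤⟨ *-monoˡ-≤ (2 ^ P * 2 ^ (P * P)) (≤ᵇ⇒≤ 3 4 _) ⟩
  4 * (2 ^ P * 2 ^ (P * P))   ≡⟨ regroup (2 ^ P) (2 ^ (P * P)) ⟩
  2 * (2 * 2 ^ P) * 2 ^ (P * P) ≡⟨ ^-distribˡ-+-* 2 (2 + P) (P * P) ⟨
  2 ^ (2 + P + P * P)         ∎
  where
  open ≤-Reasoning
  regroup : ∀ a b → 4 * (a * b) ≡ 2 * (2 * a) * b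
  regroup = solve-∀

twice[2+P+P*P]≤p^3 : ∀ {p} → 4 ≤ p → (2 + suc p + suc p * suc p) + (2 + suc p + suc p * suc p) ≤ p ^ 3
twice[2+P+P*P]≤p^3 {suc (suc (suc (suc m)))} (s≤s (s≤s (s≤s (s≤s z≤n)))) =
  ≤-trans (m≤m+n _ (26 * m + 10 * m * m + m * m * m)) (≤-reflexive (expand m))
  where
  expand : ∀ m → (2 + (5 + m) + (5 + m) * (5 + m)) + (2 + (5 + m) + (5 + m) * (5 + m))
                   + (26 * m + 10 * m * m + m * m * m)
                 ≡ (4 + m) * ((4 + m) * ((4 + m) * 1))
  expand = solve-∀

log-bounds⇒X*X<2^k : ∀ {n m k} → 16 ≤ n → ≤PowLog₂ n m → Log₂Cubed≤ n k → 3 * (suc n * m) * (3 * (suc n * m)) < 2 ^ k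
log-bounds⇒X*X<2^k {n} {m} {k} 16≤n m≤n^log₂n log₂³n≤k
  with p , 2ᵖ≤n , n<2ᵖ⁺¹ ← log₂-bracket n (<-≤-trans z<s 16≤n) = begin-strict
  X * X                    <⟨ *-mono-< X<2ᴱ X<2ᴱ ⟩
  2 ^ E * 2 ^ E            ≡⟨ ^-distribˡ-+-* 2 E E ⟨
  2 ^ (E + E)              ≤⟨ ^-monoʳ-≤ 2 (≤-trans (twice[2+P+P*P]≤p^3 {p} 4≤p) p³≤k) ⟩
  2 ^ k                    ∎
  where
  open ≤-Reasoning
  X = 3 * (suc n * m)
  E = 2 + suc p + suc p * suc p
  p³≤k : p ^ 3 ≤ k
  p³≤k = Log₂Cubed≤⇒^3≤ {n} {k} {p} log₂³n≤k 2ᵖ≤n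
  X<2ᴱ : X < 2 ^ E
  X<2ᴱ = 3[1+n]m<2^[2+P+P*P] {P = suc p} n<2ᵖ⁺¹ (≤PowLog₂⇒<2^[P*P] {n} {m} {suc p} m≤n^log₂n n<2ᵖ⁺¹)
  4≤p : 4 ≤ p
  4≤p = ≮⇒≥ λ p<4 → <⇒≱ (<-≤-trans n<2ᵖ⁺¹ (^-monoʳ-≤ 2 {suc p} {4} p<4)) 16≤n

lemma6p1 : ∃[ n₀ ] ∀ (n : ℕ) → n₀ ≤ n →
    ∀ (F : List (Subset n)) →
    ≤PowLog₂ n (length F) →
    All (λ f → Log₂Cubed≤ n ∣ f ∣) F →
    WaiterHasStrategy n (ClientGetsHundredth F)
lemma6p1 = 16 , λ n 16≤n F few-edges large-edges →
  waiterForcesHundredth F (All.map (λ {f} → log-bounds⇒X*X<2^k {k = ∣ f ∣} 16≤n few-edges) large-edges)
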